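{- If $A,B$ and $C$ are finite sets of integers, then $T(A,B,C)\le G(|A|,|B|,|C|)+\frac14$.
   Context: For finite sets $A,B,C$ of real numbers, $T(A,B,C):=\big|\{(a,b,c)\in A\times B\times C\colon a+b=2c\}\big|$. For real $x,y,z$, let $(\xi,\eta,\zeta)$ be the non-decreasing rearrangement of $(x,y,z)$ and define $G(x,y,z):=\xi\eta$ if $\zeta\ge\xi+\eta$, and $G(x,y,z):=\xi\eta-\frac14(\xi+\eta-\zeta)^2$ if $\zeta\le\xi+\eta$. -}

module Defs where

open import Data.Nat as ℕ using (ℕ; _⊔_; _⊓_; _∸_; _≤?_)
open import Data.Integer as ℤ using (ℤ; +_)
open import Data.Rational as ℚ using (ℚ; _/_)
open import Data.List using (List; length; filter; cartesianProduct)
open import Data.Product using (_×_; _,_)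
open import Relation.Nullary using (yes; no)
open import Relation.Binary.PropositionalEquality using (_≡_)

-- T(A,B,C): number of triples (a,b,c) ∈ A×B×C with a + b = 2c.
-- Finite sets are lists without duplicates (uniqueness is a hypothesis of the theorem).
T : List ℤ → List ℤ → List ℤ → ℕ
T A B C =
  length (filter (λ { ((a , b) , c) → (a ℤ.+ b) ℤ.≟ (+ 2 ℤ.* c) })
                 (cartesianProduct (cartesianProduct A B) C))

ξ η ζ : ℕ → ℕ → ℕ → ℕ
ξ x y z = x ⊓ (y ⊓ z)
ζ x y z = x ⊔ (y ⊔ z)
η x y z = ((x ℕ.+ y ℕ.+ z) ∸ ξ x y z) ∸ ζ x y z

ℕ→ℚ : ℕ → ℚ
ℕ→ℚ n = + n / 1

G : ℕ → ℕ → ℕ → ℚ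
G x y z with ξ x y z ℕ.+ η x y z ≤? ζ x y z
... | yes _ = ℕ→ℚ (ξ x y z ℕ.* η x y z)
... | no  _ = ℕ→ℚ (ξ x y z ℕ.* η x y z)
              ℚ.- (+ ((ξ x y z ℕ.+ η x y z ∸ ζ x y z) ℕ.^ 2) / 4)

{-# OPTIONS --safe #-}
module Submission where

-- Let φ be strictly increasing in its first and strictly decreasing in its second argument, and
-- let p₁ < … < pₐ and q₁ < … < q_b.  On the hook {(p₁, q)} ∪ {(p, q₁)} the values of φ are pairwise
-- distinct (those with p = p₁ are at most φ(p₁, q₁), the others exceed it), so a c-element set R
-- contains at most min(a + b − 1, c) of them.  Peeling off hooks, φ(p, q) ∈ R has at most
-- F(a, b, c) = Σ_{i < min(a,b)} min(a + b − 1 − 2i, c) solutions.  Solving a + b = 2c for the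
-- variable ranging over the largest of the three sets (φ = a + b with R = 2·C, or φ = 2c − b
-- with R = A) bounds T by F with c the largest size, and induction over the hooks gives
-- 4F(a, b, c) + (a + b − c)₊² ≤ 4ab + 1, i.e. F ≤ G + 1/4.

module Sums where

  open import Data.Nat using (ℕ; suc; _+_; _≤_; _⊓_; z≤n)
  open import Data.Nat.Properties
    using (≤-reflexive; +-mono-≤; ⊓-glb; +-commutativeSemigroup; module ≤-Reasoning)
  open import Data.Nat.ListAction using (sum)
  open import Data.Nat.ListAction.Properties using (sum-++; sum-↭)
  open import Data.List using (List; []; _∷_; _++_; map; length; filter; cartesianProduct)
  open import Data.List.Properties using (map-++; map-∘; map-cong)
  open import Data.List.Relation.Unary.All using (All; []; _∷_)
  open import Data.List.Relation.Unary.Unique.Propositional using (Unique; []; _∷_)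
  open import Data.List.Relation.Binary.Permutation.Propositional using (_↭_)
  import Data.List.Relation.Binary.Permutation.Propositional.Properties as ↭
  open import Data.Product using (_×_; _,_)
  open import Function using (_∘_; _⇔_; mk⇔; Equivalence)
  open import Relation.Binary.Definitions using (DecidableEquality)
  open import Relation.Binary.PropositionalEquality
  open import Relation.Nullary using (Dec; yes; no)
  open import Relation.Unary using (Decidable)
  open import Data.Empty using (⊥-elim)
  open import Algebra.Properties.CommutativeSemigroup +-commutativeSemigroup using (interchange)

  private variable
    A B : Set

  𝟙 : {P : Set} → Dec P → ℕ
  𝟙 (yes _) = 1
  𝟙 (no _)  = 0

  𝟙-cong : {P Q : Set} → P ⇔ Q → (p : Dec P) (q : Dec Q) → 𝟙 p ≡ 𝟙 q
  𝟙-cong _   (yes _) (yes _) = refl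
  𝟙-cong P⇔Q (yes p) (no ¬q) = ⊥-elim (¬q (Equivalence.to P⇔Q p))
  𝟙-cong P⇔Q (no ¬p) (yes q) = ⊥-elim (¬p (Equivalence.from P⇔Q q))
  𝟙-cong _   (no _)  (no _)  = refl

  ∑ : List A → (A → ℕ) → ℕ
  ∑ xs f = sum (map f xs)

  ∑-++ : (xs ys : List A) (f : A → ℕ) → ∑ (xs ++ ys) f ≡ ∑ xs f + ∑ ys f
  ∑-++ xs ys f = trans (cong sum (map-++ f xs ys)) (sum-++ (map f xs) (map f ys))

  ∑-map : (g : A → B) (xs : List A) (f : B → ℕ) → ∑ (map g xs) f ≡ ∑ xs (f ∘ g)
  ∑-map g xs f = cong sum (sym (map-∘ xs))

  ∑-cong : {f g : A → ℕ} → (∀ x → f x ≡ g x) → (xs : List A) → ∑ xs f ≡ ∑ xs g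
  ∑-cong f≗g xs = cong sum (map-cong f≗g xs)

  ∑-↭ : {xs ys : List A} (f : A → ℕ) → xs ↭ ys → ∑ xs f ≡ ∑ ys f
  ∑-↭ f xs↭ys = sum-↭ (↭.map⁺ f xs↭ys)

  ∑-zero : (xs : List A) → ∑ xs (λ _ → 0) ≡ 0
  ∑-zero []       = refl
  ∑-zero (x ∷ xs) = ∑-zero xs

  ∑-+ : (xs : List A) (f g : A → ℕ) → ∑ xs (λ x → f x + g x) ≡ ∑ xs f + ∑ xs g
  ∑-+ []       f g = refl
  ∑-+ (x ∷ xs) f g = trans (cong ((f x + g x) +_) (∑-+ xs f g))
                           (interchange (f x) (g x) (∑ xs f) (∑ xs g))

  ∑-comm : (xs : List A) (ys : List B) (h : A → B → ℕ) →
    ∑ xs (λ x → ∑ ys (h x)) ≡ ∑ ys (λ y → ∑ xs (λ x → h x y))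
  ∑-comm []       ys h = sym (∑-zero ys)
  ∑-comm (x ∷ xs) ys h = trans (cong (∑ ys (h x) +_) (∑-comm xs ys h))
                               (sym (∑-+ ys (h x) (λ y → ∑ xs (λ x → h x y))))

  ∑-cartesianProduct : (xs : List A) (ys : List B) (f : A × B → ℕ) →
    ∑ (cartesianProduct xs ys) f ≡ ∑ xs (λ x → ∑ ys (λ y → f (x , y)))
  ∑-cartesianProduct []       ys f = refl
  ∑-cartesianProduct (x ∷ xs) ys f = begin
    ∑ (map (x ,_) ys ++ cartesianProduct xs ys) f    ≡⟨ ∑-++ (map (x ,_) ys) _ f ⟩
    ∑ (map (x ,_) ys) f + ∑ (cartesianProduct xs ys) f
      ≡⟨ cong₂ _+_ (∑-map (x ,_) ys f) (∑-cartesianProduct xs ys f) ⟩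
    ∑ ys (λ y → f (x , y)) + ∑ xs (λ x → ∑ ys (λ y → f (x , y))) ∎
    where open ≡-Reasoning

  ∑≤length : {f : A → ℕ} → (∀ x → f x ≤ 1) → (xs : List A) → ∑ xs f ≤ length xs
  ∑≤length f≤1 []       = z≤n
  ∑≤length f≤1 (x ∷ xs) = +-mono-≤ (f≤1 x) (∑≤length f≤1 xs)

  length-filter≡∑𝟙 : {P : A → Set} (P? : Decidable P) (xs : List A) →
    length (filter P? xs) ≡ ∑ xs (𝟙 ∘ P?)
  length-filter≡∑𝟙 P? []       = refl
  length-filter≡∑𝟙 P? (x ∷ xs) with P? x
  ... | yes _ = cong suc (length-filter≡∑𝟙 P? xs)
  ... | no _  = length-filter≡∑𝟙 P? xs

  module Multiplicity {A : Set} (_≟_ : DecidableEquality A) where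

    multiplicity : A → List A → ℕ
    multiplicity v R = ∑ R (λ r → 𝟙 (v ≟ r))

    multiplicity-∉ : ∀ {v} (R : List A) → All (v ≢_) R → multiplicity v R ≡ 0
    multiplicity-∉ []      []         = refl
    multiplicity-∉ {v} (r ∷ R) (v≢r ∷ v∉R) with v ≟ r
    ... | yes v≡r = ⊥-elim (v≢r v≡r)
    ... | no _    = multiplicity-∉ R v∉R

    multiplicity≤1 : ∀ v {R} → Unique R → multiplicity v R ≤ 1
    multiplicity≤1 v []                  = z≤n
    multiplicity≤1 v {r ∷ R} (r∉R ∷ uR) with v ≟ r
    ... | yes refl = ≤-reflexive (cong suc (multiplicity-∉ R r∉R))
    ... | no _     = multiplicity≤1 v uR

    𝟙-≟-comm : ∀ v w → 𝟙 (v ≟ w) ≡ 𝟙 (w ≟ v)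
    𝟙-≟-comm v w = 𝟙-cong (mk⇔ sym sym) (v ≟ w) (w ≟ v)

    ∑multiplicity≤⊓ : ∀ {L R} → Unique L → Unique R →
                      ∑ L (λ v → multiplicity v R) ≤ length L ⊓ length R
    ∑multiplicity≤⊓ {L} {R} uL uR = ⊓-glb (∑≤length (λ v → multiplicity≤1 v uR) L) (begin
      ∑ L (λ v → multiplicity v R)         ≡⟨ ∑-comm L R (λ v r → 𝟙 (v ≟ r)) ⟩
      ∑ R (λ r → ∑ L (λ v → 𝟙 (v ≟ r)))     ≡⟨ ∑-cong (λ r → ∑-cong (λ v → 𝟙-≟-comm v r) L) R ⟩
      ∑ R (λ r → multiplicity r L)         ≤⟨ ∑≤length (λ r → multiplicity≤1 r uL) R ⟩
      length R                             ∎)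
      where open ≤-Reasoning

module Hooks where

  open Sums
  open import Data.Nat using (ℕ; suc; _+_; _≤_; _⊓_; z≤n)
  open import Data.Nat.Properties using (≤-reflexive; +-mono-≤; +-assoc; module ≤-Reasoning)
  open import Data.Integer as ℤ using (ℤ; _<_)
  open import Data.Integer.Properties as ℤ using (<⇒≢; <⇒≤; ≤-<-trans; ≤-refl)
  open import Data.List using (List; []; _∷_; _++_; map; length)
  open import Data.List.Properties using (length-++; length-map)
  open import Data.List.Relation.Unary.All as All using (All; []; _∷_)
  import Data.List.Relation.Unary.All.Properties as All
  open import Data.List.Relation.Unary.AllPairs as AllPairs using (AllPairs; []; _∷_)
  import Data.List.Relation.Unary.AllPairs.Properties as AllPairs
  open import Data.List.Relation.Unary.Linked.Properties using (Linked⇒AllPairs)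
  open import Data.List.Relation.Unary.Unique.Propositional using (Unique)
  open import Data.List.Relation.Binary.Permutation.Propositional using (↭-sym; ↭⇒↭ₛ)
  open import Data.List.Relation.Binary.Permutation.Propositional.Properties using (↭-length)
  import Data.List.Relation.Binary.Permutation.Setoid.Properties as ↭ₛ
  open import Data.Product using (_×_; _,_)
  open import Relation.Binary.PropositionalEquality.Properties using (setoid)
  open import Level using (0ℓ)
  open import Relation.Binary using (Rel; DecTotalOrder)
  open import Relation.Binary.PropositionalEquality

  open Multiplicity ℤ._≟_

  hookBound : ℕ → ℕ → ℕ → ℕ
  hookBound (suc a) (suc b) c = suc (b + a) ⊓ c + hookBound a b c
  hookBound _       _       _ = 0

  module _ {X Y : Set} (φ : X → Y → ℤ) where

    solutions : List X → List Y → List ℤ → ℕ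
    solutions P Q R = ∑ P (λ p → ∑ Q (λ q → multiplicity (φ p q) R))

    hook : X → Y → List X → List Y → List ℤ
    hook p₀ q₀ P Q = map (φ p₀) (q₀ ∷ Q) ++ map (λ p → φ p q₀) P

    length-hook : ∀ p₀ q₀ P Q → length (hook p₀ q₀ P Q) ≡ suc (length Q + length P)
    length-hook p₀ q₀ P Q =
      trans (length-++ (map (φ p₀) (q₀ ∷ Q)))
            (cong₂ _+_ (length-map (φ p₀) (q₀ ∷ Q)) (length-map (λ p → φ p q₀) P))

    solutions-∷ : ∀ p₀ q₀ P Q R → solutions (p₀ ∷ P) (q₀ ∷ Q) R ≡
                  ∑ (hook p₀ q₀ P Q) (λ v → multiplicity v R) + solutions P Q R
    solutions-∷ p₀ q₀ P Q R = begin
      ∑ (q₀ ∷ Q) (c p₀) + ∑ P (λ p → c p q₀ + ∑ Q (c p))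
        ≡⟨ cong (∑ (q₀ ∷ Q) (c p₀) +_) (∑-+ P (λ p → c p q₀) (λ p → ∑ Q (c p))) ⟩
      ∑ (q₀ ∷ Q) (c p₀) + (∑ P (λ p → c p q₀) + solutions P Q R)
        ≡⟨ sym (+-assoc (∑ (q₀ ∷ Q) (c p₀)) _ _) ⟩
      (∑ (q₀ ∷ Q) (c p₀) + ∑ P (λ p → c p q₀)) + solutions P Q R
        ≡⟨ cong (_+ solutions P Q R) (sym hook-sum) ⟩
      ∑ (hook p₀ q₀ P Q) m + solutions P Q R ∎
      where
      open ≡-Reasoning
      m : ℤ → ℕ
      m v = multiplicity v R
      c : X → Y → ℕ
      c p q = m (φ p q)
      hook-sum : ∑ (hook p₀ q₀ P Q) m ≡ ∑ (q₀ ∷ Q) (c p₀) + ∑ P (λ p → c p q₀)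
      hook-sum = trans (∑-++ (map (φ p₀) (q₀ ∷ Q)) _ m)
                       (cong₂ _+_ (∑-map (φ p₀) (q₀ ∷ Q) m) (∑-map (λ p → φ p q₀) P m))

    module _ {_≺₁_ : Rel X 0ℓ} {_≺₂_ : Rel Y 0ℓ}
             (φ-mono : ∀ {p p'} q → p ≺₁ p' → φ p q < φ p' q)
             (φ-anti : ∀ p {q q'} → q ≺₂ q' → φ p q' < φ p q) where

      hook-unique : ∀ {p₀ q₀ P Q} → AllPairs _≺₁_ (p₀ ∷ P) → AllPairs _≺₂_ (q₀ ∷ Q) →
                    Unique (hook p₀ q₀ P Q)
      hook-unique {p₀} {q₀} {P} {Q} (p₀≺P ∷ ≺P) ≺Q@(q₀≺Q ∷ _) =
        AllPairs.++⁺ (AllPairs.map⁺ arm) (AllPairs.map⁺ leg) corner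
        where
        arm : AllPairs (λ q q' → φ p₀ q ≢ φ p₀ q') (q₀ ∷ Q)
        arm = AllPairs.map (λ q≺q' → ≢-sym (<⇒≢ (φ-anti p₀ q≺q'))) ≺Q
        leg : AllPairs (λ p p' → φ p q₀ ≢ φ p' q₀) P
        leg = AllPairs.map (λ p≺p' → <⇒≢ (φ-mono q₀ p≺p')) ≺P
        below-leg : ∀ {q} → φ p₀ q ℤ.≤ φ p₀ q₀ → All (φ p₀ q ≢_) (map (λ p → φ p q₀) P)
        below-leg le = All.map⁺ (All.map (λ p₀≺p → <⇒≢ (≤-<-trans le (φ-mono q₀ p₀≺p))) p₀≺P)
        corner : All (λ v → All (v ≢_) (map (λ p → φ p q₀) P)) (map (φ p₀) (q₀ ∷ Q))
        corner = All.map⁺ (below-leg ≤-refl ∷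
                           All.map (λ q₀≺q → below-leg (<⇒≤ (φ-anti p₀ q₀≺q))) q₀≺Q)

      solutions≤hookBound : ∀ {P Q R} → AllPairs _≺₁_ P → AllPairs _≺₂_ Q → Unique R →
                            solutions P Q R ≤ hookBound (length P) (length Q) (length R)
      solutions≤hookBound {[]}             _  _  _  = z≤n
      solutions≤hookBound {_ ∷ P} {[]}     _  _  _  = ≤-reflexive (∑-zero P)
      solutions≤hookBound {p₀ ∷ P} {q₀ ∷ Q} {R} ≺P ≺Q uR = begin
        solutions (p₀ ∷ P) (q₀ ∷ Q) R
          ≡⟨ solutions-∷ p₀ q₀ P Q R ⟩
        ∑ (hook p₀ q₀ P Q) (λ v → multiplicity v R) + solutions P Q R
          ≤⟨ +-mono-≤ (∑multiplicity≤⊓ (hook-unique ≺P ≺Q) uR)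
                      (solutions≤hookBound (AllPairs.tail ≺P) (AllPairs.tail ≺Q) uR) ⟩
        length (hook p₀ q₀ P Q) ⊓ length R + F
          ≡⟨ cong (λ h → h ⊓ length R + F) (length-hook p₀ q₀ P Q) ⟩
        hookBound (length (p₀ ∷ P)) (length (q₀ ∷ Q)) (length R) ∎
        where
        open ≤-Reasoning
        F = hookBound (length P) (length Q) (length R)

  module StrictSort {a ℓ₁ ℓ₂} (O : DecTotalOrder a ℓ₁ ℓ₂) where

    open DecTotalOrder O using (Carrier) renaming (_≤_ to _≤ₒ_; trans to ≤ₒ-trans)
    open import Data.List.Sort O using (sort; sort-↭; sort-↗) public
    open ↭ₛ (setoid Carrier) using (Unique-resp-↭)

    _<ₛ_ : Rel Carrier _
    x <ₛ y = x ≤ₒ y × x ≢ y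

    sort-strictlyAscending : ∀ {xs} → Unique xs → AllPairs _<ₛ_ (sort xs)
    sort-strictlyAscending {xs} u =
      AllPairs.zip ( Linked⇒AllPairs ≤ₒ-trans (sort-↗ xs)
                   , Unique-resp-↭ (↭⇒↭ₛ (↭-sym (sort-↭ xs))) u)

  module _ (O₁ O₂ : DecTotalOrder 0ℓ 0ℓ 0ℓ) where

    private
      module S₁ = StrictSort O₁
      module S₂ = StrictSort O₂
      open DecTotalOrder O₁ using () renaming (Carrier to X)
      open DecTotalOrder O₂ using () renaming (Carrier to Y)

    solutions≤hookBound-unique : (φ : X → Y → ℤ) →
      (∀ {p p'} q → p S₁.<ₛ p' → φ p q < φ p' q) →
      (∀ p {q q'} → q S₂.<ₛ q' → φ p q' < φ p q) →
      ∀ {P Q R} → Unique P → Unique Q → Unique R →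
      solutions φ P Q R ≤ hookBound (length P) (length Q) (length R)
    solutions≤hookBound-unique φ φ-mono φ-anti {P} {Q} {R} uP uQ uR = begin
      solutions φ P Q R
        ≡⟨ ∑-↭ _ (↭-sym (S₁.sort-↭ P)) ⟩
      solutions φ (S₁.sort P) Q R
        ≡⟨ ∑-cong (λ p → ∑-↭ _ (↭-sym (S₂.sort-↭ Q))) (S₁.sort P) ⟩
      solutions φ (S₁.sort P) (S₂.sort Q) R
        ≤⟨ solutions≤hookBound φ φ-mono φ-anti
             (S₁.sort-strictlyAscending uP) (S₂.sort-strictlyAscending uQ) uR ⟩
      hookBound (length (S₁.sort P)) (length (S₂.sort Q)) (length R)
        ≡⟨ cong₂ (λ a b → hookBound a b (length R))
                 (↭-length (S₁.sort-↭ P)) (↭-length (S₂.sort-↭ Q)) ⟩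
      hookBound (length P) (length Q) (length R) ∎
      where open ≤-Reasoning

module Progressions where

  open Sums
  open Hooks
  open import Defs using (T)
  open import Data.Nat using (ℕ; _≤_)
  open import Data.Nat.Properties using (module ≤-Reasoning)
  open import Data.Integer as ℤ using (ℤ; +_; _+_; _-_; _*_; _<_)
  open import Data.Integer.Properties as ℤ
    using (≤∧≢⇒<; +-comm; +-monoˡ-<; +-monoʳ-<; *-monoˡ-<-pos; neg-mono-<; *-cancelˡ-≡;
           ≤-decTotalOrder; +-0-abelianGroup)
  open import Algebra.Properties.AbelianGroup +-0-abelianGroup
    using (//-rightDividesˡ; //-rightDividesʳ)
  open import Relation.Binary.Properties.DecTotalOrder ≤-decTotalOrder using (≥-decTotalOrder)
  open import Data.List using (List; map; length; cartesianProduct)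
  open import Data.List.Properties using (length-map)
  open import Data.List.Relation.Unary.Unique.Propositional using (Unique)
  import Data.List.Relation.Unary.Unique.Propositional.Properties as Unique
  open import Data.Product using (_×_; _,_)
  open import Function using (_⇔_; mk⇔)
  open import Relation.Binary.PropositionalEquality

  private variable
    X Y Z : Set

  ∑³ : List X → List Y → List Z → (X → Y → Z → ℕ) → ℕ
  ∑³ xs ys zs h = ∑ xs (λ x → ∑ ys (λ y → ∑ zs (λ z → h x y z)))

  ∑³-cong : {h h′ : X → Y → Z → ℕ} → (∀ x y z → h x y z ≡ h′ x y z) →
            ∀ xs ys zs → ∑³ xs ys zs h ≡ ∑³ xs ys zs h′
  ∑³-cong h≗h′ xs ys zs = ∑-cong (λ x → ∑-cong (λ y → ∑-cong (h≗h′ x y) zs) ys) xs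

  ∑³-swap₁₂ : ∀ (xs : List X) (ys : List Y) (zs : List Z) h →
              ∑³ xs ys zs h ≡ ∑³ ys xs zs (λ y x z → h x y z)
  ∑³-swap₁₂ xs ys zs h = ∑-comm xs ys (λ x y → ∑ zs (h x y))

  ∑³-swap₁₃ : ∀ (xs : List X) (ys : List Y) (zs : List Z) h →
              ∑³ xs ys zs h ≡ ∑³ zs ys xs (λ z y x → h x y z)
  ∑³-swap₁₃ xs ys zs h = begin
    ∑³ xs ys zs h
      ≡⟨ ∑-cong (λ x → ∑-comm ys zs (h x)) xs ⟩
    ∑ xs (λ x → ∑ zs (λ z → ∑ ys (λ y → h x y z)))
      ≡⟨ ∑-comm xs zs _ ⟩
    ∑ zs (λ z → ∑ xs (λ x → ∑ ys (λ y → h x y z)))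
      ≡⟨ ∑-cong (λ z → ∑-comm xs ys _) zs ⟩
    ∑³ zs ys xs (λ z y x → h x y z) ∎
    where open ≡-Reasoning

  open Multiplicity ℤ._≟_

  2* : ℤ → ℤ
  2* c = + 2 * c

  T≡∑³ : ∀ A B C → T A B C ≡ ∑³ A B C (λ a b c → 𝟙 (a + b ℤ.≟ 2* c))
  T≡∑³ A B C =
    trans (length-filter≡∑𝟙 _ (cartesianProduct (cartesianProduct A B) C))
   (trans (∑-cartesianProduct (cartesianProduct A B) C _)
          (∑-cartesianProduct A B (λ (a , b) → ∑ C (λ c → 𝟙 (a + b ℤ.≟ 2* c)))))

  T-comm : ∀ A B C → T A B C ≡ T B A C
  T-comm A B C = begin
    T A B C                                          ≡⟨ T≡∑³ A B C ⟩
    ∑³ A B C (λ a b c → 𝟙 (a + b ℤ.≟ 2* c))          ≡⟨ ∑³-swap₁₂ A B C _ ⟩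
    ∑³ B A C (λ b a c → 𝟙 (a + b ℤ.≟ 2* c))
      ≡⟨ ∑³-cong (λ b a c → cong (λ s → 𝟙 (s ℤ.≟ 2* c)) (+-comm a b)) B A C ⟩
    ∑³ B A C (λ b a c → 𝟙 (b + a ℤ.≟ 2* c))          ≡⟨ sym (T≡∑³ B A C) ⟩
    T B A C ∎
    where open ≡-Reasoning

  -- a + b increases in b, so B is sorted by ≥.
  T≤hookBound-ABC : ∀ {A B C} → Unique A → Unique B → Unique C →
                    T A B C ≤ hookBound (length A) (length B) (length C)
  T≤hookBound-ABC {A} {B} {C} uA uB uC = begin
    T A B C
      ≡⟨ T≡∑³ A B C ⟩
    ∑³ A B C (λ a b c → 𝟙 (a + b ℤ.≟ 2* c))
      ≡⟨ ∑-cong (λ a → ∑-cong (λ b → sym (∑-map 2* C _)) B) A ⟩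
    solutions _+_ A B (map 2* C)
      ≤⟨ solutions≤hookBound-unique ≤-decTotalOrder ≥-decTotalOrder _+_ mono anti
           uA uB (Unique.map⁺ (*-cancelˡ-≡ (+ 2) _ _) uC) ⟩
    hookBound (length A) (length B) (length (map 2* C))
      ≡⟨ cong (hookBound (length A) (length B)) (length-map 2* C) ⟩
    hookBound (length A) (length B) (length C) ∎
    where
    open ≤-Reasoning
    mono : ∀ {a a′} b → a ℤ.≤ a′ × a ≢ a′ → a + b < a′ + b
    mono b (a≤a′ , a≢a′) = +-monoˡ-< b (≤∧≢⇒< a≤a′ a≢a′)
    anti : ∀ a {b b′} → b′ ℤ.≤ b × b ≢ b′ → a + b′ < a + b
    anti a (b′≤b , b≢b′) = +-monoʳ-< a (≤∧≢⇒< b′≤b (≢-sym b≢b′))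

  T≤hookBound-CBA : ∀ {A B C} → Unique A → Unique B → Unique C →
                     T A B C ≤ hookBound (length C) (length B) (length A)
  T≤hookBound-CBA {A} {B} {C} uA uB uC = begin
    T A B C
      ≡⟨ T≡∑³ A B C ⟩
    ∑³ A B C (λ a b c → 𝟙 (a + b ℤ.≟ 2* c))
      ≡⟨ ∑³-swap₁₃ A B C _ ⟩
    ∑³ C B A (λ c b a → 𝟙 (a + b ℤ.≟ 2* c))
      ≡⟨ ∑³-cong (λ c b a → 𝟙-cong sum⇔difference (a + b ℤ.≟ 2* c) (2* c - b ℤ.≟ a))
                 C B A ⟩
    solutions (λ c b → 2* c - b) C B A
      ≤⟨ solutions≤hookBound-unique ≤-decTotalOrder ≤-decTotalOrder _ mono anti uC uB uA ⟩
    hookBound (length C) (length B) (length A) ∎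
    where
    open ≤-Reasoning
    sum⇔difference : ∀ {a b c} → a + b ≡ 2* c ⇔ 2* c - b ≡ a
    sum⇔difference {a} {b} {c} = mk⇔
      (λ e → trans (cong (_- b) (sym e)) (//-rightDividesʳ b a))
      (λ e → trans (cong (_+ b) (sym e)) (//-rightDividesˡ b (2* c)))
    mono : ∀ {c c′} b → c ℤ.≤ c′ × c ≢ c′ → 2* c - b < 2* c′ - b
    mono b (c≤c′ , c≢c′) = +-monoˡ-< (ℤ.- b) (*-monoˡ-<-pos (+ 2) (≤∧≢⇒< c≤c′ c≢c′))
    anti : ∀ c {b b′} → b ℤ.≤ b′ × b ≢ b′ → 2* c - b′ < 2* c - b
    anti c (b≤b′ , b≢b′) = +-monoʳ-< (2* c) (neg-mono-< (≤∧≢⇒< b≤b′ b≢b′))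

module HookArithmetic where

  open Hooks using (hookBound)
  open import Data.Nat using (zero; suc; _+_; _*_; _∸_; _^_; _≤_; _⊓_; z≤n; s≤s)
  open import Data.Nat.Properties
  open import Data.Nat.Tactic.RingSolver using (solve-∀)
  open import Data.Empty using (⊥-elim)
  open import Data.Sum using (inj₁; inj₂)
  open import Relation.Binary.PropositionalEquality

  hookBound≤* : ∀ a b c → hookBound a b c ≤ a * b
  hookBound≤* zero    _       _ = z≤n
  hookBound≤* (suc a) zero    _ = z≤n
  hookBound≤* (suc a) (suc b) c = begin
    suc (b + a) ⊓ c + hookBound a b c ≤⟨ +-mono-≤ (m⊓n≤m _ c) (hookBound≤* a b c) ⟩
    suc (b + a) + a * b               ≡⟨ expand a b ⟩
    suc a * suc b                     ∎
    where
    open ≤-Reasoning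
    expand : ∀ a b → suc (b + a) + a * b ≡ suc a * suc b
    expand = solve-∀

  quarter-slack : ∀ a b c {d} → d ≤ 1 → 4 * hookBound a b c + d * d ≤ 4 * (a * b) + 1
  quarter-slack a b c d≤1 = +-mono-≤ (*-monoʳ-≤ 4 (hookBound≤* a b c)) (d²≤1 d≤1)
    where
    d²≤1 : ∀ {d} → d ≤ 1 → d * d ≤ 1
    d²≤1 z≤n       = z≤n
    d²≤1 (s≤s z≤n) = s≤s z≤n

  -- From (a, b) to (a + 1, b + 1), 4F grows by at most 4c and d² by 4d + 4, together by
  -- 4(a + b + 1), which is exactly the growth of 4ab.
  hookBound-quarter-≡ : ∀ {a b c} d → a ≤ c → b ≤ c → a + b ≡ d + c →
                        4 * hookBound a b c + d * d ≤ 4 * (a * b) + 1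
  hookBound-quarter-≡ {a} {b} {c} 0 _ _ _ = quarter-slack a b c z≤n
  hookBound-quarter-≡ {a} {b} {c} 1 _ _ _ = quarter-slack a b c (s≤s z≤n)
  hookBound-quarter-≡ {zero} {b} {c} (suc (suc d)) _ b≤c b≡d+c =
    ⊥-elim (m+n≮n (suc d) c (subst (_≤ c) b≡d+c b≤c))
  hookBound-quarter-≡ {suc a} {zero} {c} (suc (suc d)) a≤c _ a+0≡d+c =
    ⊥-elim (m+n≮n (suc d) c (subst (_≤ c) (trans (sym (+-identityʳ (suc a))) a+0≡d+c) a≤c))
  hookBound-quarter-≡ {suc a} {suc b} {c} (suc (suc d)) a≤c b≤c eq = begin
    4 * (suc (b + a) ⊓ c + hookBound a b c) + (2 + d) * (2 + d)
      ≤⟨ +-monoˡ-≤ ((2 + d) * (2 + d))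
                   (*-monoʳ-≤ 4 (+-monoˡ-≤ (hookBound a b c) (m⊓n≤n (suc (b + a)) c))) ⟩
    4 * (c + hookBound a b c) + (2 + d) * (2 + d)
      ≡⟨ peel c (hookBound a b c) d ⟩
    (4 * hookBound a b c + d * d) + 4 * (d + c) + 4
      ≤⟨ +-monoˡ-≤ 4 (+-monoˡ-≤ (4 * (d + c)) IH) ⟩
    (4 * (a * b) + 1) + 4 * (d + c) + 4
      ≡⟨ cong (λ s → (4 * (a * b) + 1) + 4 * s + 4) (sym a+b≡d+c) ⟩
    (4 * (a * b) + 1) + 4 * (a + b) + 4
      ≡⟨ unpeel a b ⟩
    4 * (suc a * suc b) + 1 ∎
    where
    open ≤-Reasoning
    peel : ∀ c f d → 4 * (c + f) + (2 + d) * (2 + d) ≡ (4 * f + d * d) + 4 * (d + c) + 4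
    peel = solve-∀
    unpeel : ∀ a b → (4 * (a * b) + 1) + 4 * (a + b) + 4 ≡ 4 * (suc a * suc b) + 1
    unpeel = solve-∀
    a+b≡d+c : a + b ≡ d + c
    a+b≡d+c = suc-injective (trans (sym (+-suc a b)) (suc-injective eq))
    IH = hookBound-quarter-≡ d (≤-trans (n≤1+n a) a≤c) (≤-trans (n≤1+n b) b≤c) a+b≡d+c

  hookBound-quarter : ∀ {a b c} → a ≤ c → b ≤ c →
                      4 * hookBound a b c + (a + b ∸ c) ^ 2 ≤ 4 * (a * b) + 1
  hookBound-quarter {a} {b} {c} a≤c b≤c with ≤-total (a + b) c
  ... | inj₁ a+b≤c rewrite m≤n⇒m∸n≡0 a+b≤c = quarter-slack a b c z≤n
  ... | inj₂ c≤a+b = subst (λ s → 4 * hookBound a b c + s ≤ 4 * (a * b) + 1)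
                           (sym (cong (d *_) (*-identityʳ d)))
                           (hookBound-quarter-≡ d a≤c b≤c (sym (m∸n+n≡m c≤a+b)))
    where d = a + b ∸ c

module GFunction where

  open import Defs using (ξ; η; ζ; G; ℕ→ℚ)
  open Hooks using (hookBound)
  open HookArithmetic using (hookBound-quarter)
  open import Data.Nat as ℕ using (ℕ; _+_; _*_; _∸_; _^_; _≤_; _⊓_; _⊔_; _≤?_)
  open import Data.Nat.Properties
  open import Data.Integer as ℤ using (+_; +≤+)
  import Data.Integer.Properties as ℤ
  import Data.Integer.Tactic.RingSolver as ℤ-Solver
  open import Data.Rational as ℚ using (ℚ; _/_; toℚᵘ)
  import Data.Rational.Properties as ℚ
  open import Data.Rational.Unnormalised as ℚᵘ using (mkℚᵘ; *≤*; _≃_)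
  import Data.Rational.Unnormalised.Properties as ℚᵘ
  open import Data.Product using (_×_; _,_)
  open import Data.Sum using (inj₁; inj₂)
  open import Relation.Nullary using (yes; no)
  open import Relation.Binary.PropositionalEquality
  import Algebra.Properties.CommutativeSemigroup as CommSemigroup
  open CommSemigroup ⊓-commutativeSemigroup
    using () renaming (x∙yz≈y∙xz to ⊓-swap₁₂; x∙yz≈z∙yx to ⊓-swap₁₃)
  open CommSemigroup ⊔-commutativeSemigroup
    using () renaming (x∙yz≈y∙xz to ⊔-swap₁₂; x∙yz≈z∙yx to ⊔-swap₁₃)
  open CommSemigroup +-commutativeSemigroup
    using () renaming (xy∙z≈yx∙z to +-swap₁₂; xy∙z≈zy∙x to +-swap₁₃)

  -- Both branches of G in one formula: the truncated a + b ∸ c vanishes exactly when c ≥ a + b.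
  Gₛ : ℕ → ℕ → ℕ → ℚ
  Gₛ a b c = ℕ→ℚ (a * b) ℚ.- + ((a + b ∸ c) ^ 2) / 4

  Gₛ-cong : ∀ {a b c a′ b′ c′} → a ≡ a′ → b ≡ b′ → c ≡ c′ → Gₛ a b c ≡ Gₛ a′ b′ c′
  Gₛ-cong refl refl refl = refl

  Gₛ-comm : ∀ a b c → Gₛ a b c ≡ Gₛ b a c
  Gₛ-comm a b c = cong₂ (λ p s → ℕ→ℚ p ℚ.- + ((s ∸ c) ^ 2) / 4) (*-comm a b) (+-comm a b)

  G≡Gₛ : ∀ x y z → G x y z ≡ Gₛ (ξ x y z) (η x y z) (ζ x y z)
  G≡Gₛ x y z with ξ x y z + η x y z ≤? ζ x y z
  ... | no _      = refl
  ... | yes ξ+η≤ζ = begin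
    ℕ→ℚ p                           ≡⟨ sym (ℚ.+-identityʳ (ℕ→ℚ p)) ⟩ -- - (+ 0 / 4) computes to 0ℚ
    ℕ→ℚ p ℚ.- + (0 ^ 2) / 4
      ≡⟨ cong (λ d → ℕ→ℚ p ℚ.- + (d ^ 2) / 4) (sym (m≤n⇒m∸n≡0 ξ+η≤ζ)) ⟩
    Gₛ (ξ x y z) (η x y z) (ζ x y z) ∎
    where
    open ≡-Reasoning
    p = ξ x y z * η x y z

  G-cong : ∀ {x y z x′ y′ z′} → ξ x y z ≡ ξ x′ y′ z′ → ζ x y z ≡ ζ x′ y′ z′ →
           x + y + z ≡ x′ + y′ + z′ → G x y z ≡ G x′ y′ z′
  G-cong {x} {y} {z} {x′} {y′} {z′} ξ≡ ζ≡ sum≡ = begin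
    G x y z                              ≡⟨ G≡Gₛ x y z ⟩
    Gₛ (ξ x y z) (η x y z) (ζ x y z)     ≡⟨ Gₛ-cong ξ≡ (cong₂ _∸_ (cong₂ _∸_ sum≡ ξ≡) ζ≡) ζ≡ ⟩
    Gₛ (ξ x′ y′ z′) (η x′ y′ z′) (ζ x′ y′ z′)
                                         ≡⟨ sym (G≡Gₛ x′ y′ z′) ⟩
    G x′ y′ z′                           ∎
    where open ≡-Reasoning

  G-swap₁₂ : ∀ x y z → G x y z ≡ G y x z
  G-swap₁₂ x y z = G-cong (⊓-swap₁₂ x y z) (⊔-swap₁₂ x y z) (+-swap₁₂ x y z)

  G-swap₁₃ : ∀ x y z → G x y z ≡ G z y x
  G-swap₁₃ x y z = G-cong (⊓-swap₁₃ x y z) (⊔-swap₁₃ x y z) (+-swap₁₃ x y z)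

  sorted-≤ : ∀ {x y z} → x ≤ y → y ≤ z → ξ x y z ≡ x × η x y z ≡ y × ζ x y z ≡ z
  sorted-≤ {x} {y} {z} x≤y y≤z = ξ≡x , η≡y , ζ≡z
    where
    ξ≡x = trans (cong (x ⊓_) (m≤n⇒m⊓n≡m y≤z)) (m≤n⇒m⊓n≡m x≤y)
    ζ≡z = trans (cong (x ⊔_) (m≤n⇒m⊔n≡n y≤z)) (m≤n⇒m⊔n≡n (≤-trans x≤y y≤z))
    η≡y = begin
      (x + y + z ∸ ξ x y z) ∸ ζ x y z ≡⟨ cong₂ (λ a c → (x + y + z ∸ a) ∸ c) ξ≡x ζ≡z ⟩
      (x + y + z ∸ x) ∸ z             ≡⟨ cong (λ s → s ∸ x ∸ z) (+-assoc x y z) ⟩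
      (x + (y + z) ∸ x) ∸ z           ≡⟨ cong (_∸ z) (m+n∸m≡n x (y + z)) ⟩
      y + z ∸ z                       ≡⟨ m+n∸n≡m y z ⟩
      y                               ∎
      where open ≡-Reasoning

  G-max-last : ∀ {x y z} → x ≤ z → y ≤ z → G x y z ≡ Gₛ x y z
  G-max-last {x} {y} {z} x≤z y≤z with ≤-total x y
  ... | inj₁ x≤y = let ξ≡ , η≡ , ζ≡ = sorted-≤ x≤y y≤z in
    trans (G≡Gₛ x y z) (Gₛ-cong ξ≡ η≡ ζ≡)
  ... | inj₂ y≤x = let ξ≡ , η≡ , ζ≡ = sorted-≤ y≤x x≤z in
    trans (G-swap₁₂ x y z) (trans (G≡Gₛ y x z) (trans (Gₛ-cong ξ≡ η≡ ζ≡) (Gₛ-comm y x z)))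

  quarter-bound : ∀ {n m k} → 4 * n + k ≤ 4 * m + 1 →
                  ℕ→ℚ n ℚ.≤ ℕ→ℚ m ℚ.- + k / 4 ℚ.+ + 1 / 4
  quarter-bound {n} {m} {k} h = ℚ.toℚᵘ-cancel-≤
    (ℚᵘ.≤-respˡ-≃ (ℚᵘ.≃-sym (fraction n 0)) (ℚᵘ.≤-respʳ-≃ (ℚᵘ.≃-sym rhs) (*≤* cross)))
    where
    fraction : ∀ i d → toℚᵘ (+ i / ℕ.suc d) ≃ mkℚᵘ (+ i) d
    fraction i d = ℚ.toℚᵘ-fromℚᵘ (mkℚᵘ (+ i) d)
    rhs : toℚᵘ (ℕ→ℚ m ℚ.- + k / 4 ℚ.+ + 1 / 4) ≃ mkℚᵘ (+ m) 0 ℚᵘ.- mkℚᵘ (+ k) 3 ℚᵘ.+ mkℚᵘ (+ 1) 3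
    rhs = ℚᵘ.≃-trans (ℚ.toℚᵘ-homo-+ (ℕ→ℚ m ℚ.- + k / 4) (+ 1 / 4)) (ℚᵘ.+-cong m-k/4 (fraction 1 3))
      where
      neg-k/4 = ℚᵘ.≃-trans (ℚ.toℚᵘ-homo‿- (+ k / 4)) (ℚᵘ.-‿cong (fraction k 3))
      m-k/4   = ℚᵘ.≃-trans (ℚ.toℚᵘ-homo-+ (ℕ→ℚ m) (ℚ.- (+ k / 4))) (ℚᵘ.+-cong (fraction m 0) neg-k/4)
    -- The cross-multiplied inequality, in the shape in which ℚᵘ._+_ leaves the right-hand side.
    cross : + n ℤ.* + 16 ℤ.≤ ((+ m ℤ.* + 4 ℤ.+ ℤ.- + k ℤ.* + 1) ℤ.* + 4 ℤ.+ + 1 ℤ.* + 4) ℤ.* + 1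
    cross = begin
      + n ℤ.* + 16
        ≡⟨ clear-k (+ n) (+ k) ⟩
      + 4 ℤ.* ((+ 4 ℤ.* + n ℤ.+ + k) ℤ.- + k)
        ≤⟨ ℤ.*-monoˡ-≤-nonNeg (+ 4) (ℤ.+-monoˡ-≤ (ℤ.- + k) h′) ⟩
      + 4 ℤ.* ((+ 4 ℤ.* + m ℤ.+ + 1) ℤ.- + k)
        ≡⟨ expand (+ m) (+ k) ⟩
      ((+ m ℤ.* + 4 ℤ.+ ℤ.- + k ℤ.* + 1) ℤ.* + 4 ℤ.+ + 1 ℤ.* + 4) ℤ.* + 1 ∎
      where
      open ℤ.≤-Reasoning
      clear-k : ∀ N K → N ℤ.* + 16 ≡ + 4 ℤ.* ((+ 4 ℤ.* N ℤ.+ K) ℤ.- K)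
      clear-k = ℤ-Solver.solve-∀
      expand : ∀ M K → + 4 ℤ.* ((+ 4 ℤ.* M ℤ.+ + 1) ℤ.- K) ≡
                       ((M ℤ.* + 4 ℤ.+ ℤ.- K ℤ.* + 1) ℤ.* + 4 ℤ.+ + 1 ℤ.* + 4) ℤ.* + 1
      expand = ℤ-Solver.solve-∀
      embed : ∀ a b → + (4 * a + b) ≡ + 4 ℤ.* + a ℤ.+ + b
      embed a b = trans (ℤ.pos-+ (4 * a) b) (cong (ℤ._+ + b) (ℤ.pos-* 4 a))
      h′ : + 4 ℤ.* + n ℤ.+ + k ℤ.≤ + 4 ℤ.* + m ℤ.+ + 1
      h′ = subst₂ ℤ._≤_ (embed n k) (embed m 1) (+≤+ h)

  ≤hookBound⇒≤G+¼ : ∀ {x y z n} → x ≤ z → y ≤ z → n ≤ hookBound x y z →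
                    ℕ→ℚ n ℚ.≤ G x y z ℚ.+ + 1 / 4
  ≤hookBound⇒≤G+¼ {x} {y} {z} {n} x≤z y≤z n≤F =
    subst (λ g → ℕ→ℚ n ℚ.≤ g ℚ.+ + 1 / 4) (sym (G-max-last x≤z y≤z))
          (quarter-bound {n} {x * y} {d²} (≤-trans (+-monoˡ-≤ d² (*-monoʳ-≤ 4 n≤F))
                                                   (hookBound-quarter x≤z y≤z)))
    where d² = (x + y ∸ z) ^ 2

open import Defs
open import Data.Integer using (ℤ; +_)
open import Data.Rational using (_≤_; _+_; _/_)
open import Data.List using (List; length)
open import Data.List.Relation.Unary.Unique.Propositional using (Unique)

open Progressions using (T-comm; T≤hookBound-ABC; T≤hookBound-CBA)
open GFunction using (G-swap₁₂; G-swap₁₃; ≤hookBound⇒≤G+¼)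
import Data.Nat as ℕ
open import Data.Nat.Properties using (≤-total; ≤-trans)
open import Data.Product using (_×_; _,_)
open import Data.Sum using (_⊎_; inj₁; inj₂)
open import Relation.Binary.PropositionalEquality using (sym; subst; subst₂)

largest-of-three : ∀ x y z → (x ℕ.≤ z × y ℕ.≤ z) ⊎ (y ℕ.≤ x × z ℕ.≤ x) ⊎ (x ℕ.≤ y × z ℕ.≤ y)
largest-of-three x y z with ≤-total x y | ≤-total y z | ≤-total x z
... | inj₁ x≤y | inj₁ y≤z | _        = inj₁ (≤-trans x≤y y≤z , y≤z)
... | inj₁ x≤y | inj₂ z≤y | _        = inj₂ (inj₂ (x≤y , z≤y))
... | inj₂ y≤x | _        | inj₁ x≤z = inj₁ (x≤z , ≤-trans y≤x x≤z)
... | inj₂ y≤x | _        | inj₂ z≤x = inj₂ (inj₁ (y≤x , z≤x))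

T≤G+¼-first-largest : ∀ {A B C} → Unique A → Unique B → Unique C →
  length B ℕ.≤ length A → length C ℕ.≤ length A →
  ℕ→ℚ (T A B C) ≤ G (length A) (length B) (length C) + (+ 1 / 4)
T≤G+¼-first-largest {A} {B} {C} uA uB uC b≤a c≤a =
  subst (λ g → ℕ→ℚ (T A B C) ≤ g + (+ 1 / 4)) (sym (G-swap₁₃ (length A) (length B) (length C)))
        (≤hookBound⇒≤G+¼ c≤a b≤a (T≤hookBound-CBA uA uB uC))

corollary2 : (A B C : List ℤ) → Unique A → Unique B → Unique C →
    ℕ→ℚ (T A B C) ≤ G (length A) (length B) (length C) + (+ 1 / 4)
corollary2 A B C uA uB uC with largest-of-three (length A) (length B) (length C)
... | inj₁ (a≤c , b≤c)         = ≤hookBound⇒≤G+¼ a≤c b≤c (T≤hookBound-ABC uA uB uC)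
... | inj₂ (inj₁ (b≤a , c≤a)) = T≤G+¼-first-largest uA uB uC b≤a c≤a
... | inj₂ (inj₂ (a≤b , c≤b)) =
  subst₂ (λ t g → ℕ→ℚ t ≤ g + (+ 1 / 4))
         (sym (T-comm A B C)) (sym (G-swap₁₂ (length A) (length B) (length C)))
         (T≤G+¼-first-largest uB uA uC a≤b c≤b)
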